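{- Let $\rho=\sum_{i\ge0}b_{i+1}q_i$ be an $\alpha$-number of a slope $\alpha$ and let $n\ge1$. If there exists $N\ge n$ with $b_{N+1}\neq0$, let $N$ be the smallest such integer; then the longest common prefix of $T^\rho(c_\alpha)$ and $T^{\rho_n}(c_\alpha)$ has length $\lambda_N=q_{N+1}+q_N-\rho_{N+1}-2$. If no such $N$ exists, then $T^\rho(c_\alpha)=T^{\rho_n}(c_\alpha)$.
   Context: Slope: irrational $\alpha\in(0,1)$, $\alpha=[0;a_1,a_2,\ldots]$; continuants $q_{ -1}=0,q_0=1,q_{n+1}=a_{n+1}q_n+q_{n-1}$. Standard words $s_{ -1}=1,s_0=0,s_1=s_0^{a_1-1}s_{ -1},s_{n+1}=s_n^{a_{n+1}}s_{n-1}$; characteristic word $c_\alpha=\lim s_n$; $T$ is the shift. Ostrowski conditions on $(b_i)_{i\ge1}$: $0\le b_1\le a_1-1$, $0\le b_i\le a_i$, $b_{i+1}=a_{i+1}\Rightarrow b_i=0$. An $\alpha$-number is a formal sum $\rho=\sum_{i\ge0}b_{i+1}q_i$ with $(b_i)$ satisfying these conditions; $\rho_n=\sum_{i=0}^{n-1}b_{i+1}q_i$. $T^\rho(c_\alpha)$ is the infinite word which, for every $n\ge1$, has the same prefix of length $q_n-1$ as $T^{\rho_n}(c_\alpha)$. -}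

module Defs where

open import Data.Nat using (ℕ; zero; suc; _+_; _*_; _∸_; _≤_; _<_)
open import Data.List using (List; []; _∷_; _++_; concat; replicate)
open import Data.Product using (_×_)
open import Relation.Binary.PropositionalEquality using (_≡_; _≢_)

-- A slope α = [0; a₁, a₂, …] (irrational in (0,1)) is given by its sequence of
-- partial quotients a : ℕ → ℕ, read at indices 1,2,… (a 0 is unused),
-- with a i ≥ 1 for i ≥ 1.
IsSlope : (ℕ → ℕ) → Set
IsSlope a = ∀ i → 1 ≤ a (suc i)

q : (ℕ → ℕ) → ℕ → ℕ
q a zero = 1
q a (suc zero) = a 1
q a (suc (suc n)) = a (suc (suc n)) * q a (suc n) + q a n

-- Words over the alphabet {0,1} (letters are the naturals 0 and 1).
Word : Set
Word = List ℕ

pow : ℕ → Word → Word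
pow k w = concat (replicate k w)

-- Standard words s₀ = 0, s₁ = s₀^(a₁-1) s₋₁ (s₋₁ = 1), s (n+2) = s(n+1)^(a(n+2)) s n.
s : (ℕ → ℕ) → ℕ → Word
s a zero = 0 ∷ []
s a (suc zero) = pow (a 1 ∸ 1) (0 ∷ []) ++ (1 ∷ [])
s a (suc (suc n)) = pow (a (suc (suc n))) (s a (suc n)) ++ s a n

-- k-th letter (0-indexed) of a finite word; default 0 outside the word
-- (never used below, see c).
nth : Word → ℕ → ℕ
nth [] k = 0
nth (x ∷ w) zero = x
nth (x ∷ w) (suc k) = nth w k

InfWord : Set
InfWord = ℕ → ℕ

-- Characteristic word c_α = lim s n.  For n ≥ 1, s n is a prefix of s (n+1),
-- and |s (k+2)| = q (k+2) ≥ k+2 > k, so letter k of c_α is letter k of s (k+2).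
c : (ℕ → ℕ) → InfWord
c a k = nth (s a (suc (suc k))) k

T^ : ℕ → InfWord → InfWord
T^ m w k = w (m + k)

-- Ostrowski conditions on b (read at indices 1,2,…; b 0 unused).
Ostrowski : (ℕ → ℕ) → (ℕ → ℕ) → Set
Ostrowski a b =
  (b 1 ≤ a 1 ∸ 1)
  × (∀ i → b (suc i) ≤ a (suc i))
  × (∀ i → b (suc (suc i)) ≡ a (suc (suc i)) → b (suc i) ≡ 0)

ρ : (ℕ → ℕ) → (ℕ → ℕ) → ℕ → ℕ
ρ a b zero = 0
ρ a b (suc n) = ρ a b n + b (suc n) * q a n

-- T^ρ(c_α): the infinite word agreeing with T^{ρ_n}(c_α) on the prefix of
-- length q_n - 1 for every n ≥ 1.  Letter k is taken from n = k+2
-- (q (k+2) - 1 ≥ k+1 > k); consistency for other n is the paper's lemma.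
Tρc : (ℕ → ℕ) → (ℕ → ℕ) → InfWord
Tρc a b k = T^ (ρ a b (suc (suc k))) (c a) k

LCPLength : InfWord → InfWord → ℕ → Set
LCPLength u v L = (∀ k → k < L → u k ≡ v k) × (u L ≢ v L)

lamN : (ℕ → ℕ) → (ℕ → ℕ) → ℕ → ℕ
lamN a b N = q a (suc N) + q a N ∸ ρ a b (suc N) ∸ 2

-- The recursion s_{m+2} = s_{m+1}^{a_{m+2}} s_m makes s_{m+1} s_m and s_m s_{m+1}
-- equal except for their last two letters, which are swapped.  Now s_{i+2} s_{i+1}
-- is a prefix of s_{i+3}, hence of c_α, and dropping the first q_{i+1} letters of
-- s_{i+1} s_{i+2} leaves s_{i+2}, again a prefix of c_α; so c_α has period q_{i+1}
-- on its first q_{i+2} + q_{i+1} - 2 letters, and this period breaks at exactly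
-- that position.  Since ρ_{i+2} = ρ_{i+1} + b_{i+2} q_{i+1}, shifting c_α by ρ_{i+2}
-- instead of ρ_{i+1} moves b_{i+2} periods to the right, so the two shifts agree
-- on exactly λ_{i+1} letters when b_{i+2} ≠ 0, and on at least q_{i+1} - 1 letters
-- in any case; the Ostrowski conditions enter only through ρ_m < q_m.  Hence
-- T^ρ(c_α) is read off T^{ρ_{i+1}}(c_α) on its first q_{i+1} - 1 letters, and
-- ρ_N = ρ_n whenever b_{n+1}, …, b_N vanish.

module Submission where

open import Defs
open import Data.Nat using (ℕ; zero; suc; _+_; _*_; _∸_; _≤_; _<_; _≤′_; ≤′-refl; ≤′-step; z≤n; s≤s; _≟_; ≢-nonZero)
open import Data.Nat.Properties
open import Data.List using ([]; _∷_; _++_; length)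
open import Data.List.Properties using (length-++; length-++-≤ˡ; ++-assoc; ++-identityʳ)
open import Data.Product using (_×_; _,_; proj₁; proj₂; ∃; ∃₂)
open import Data.Sum using (inj₁; inj₂)
open import Relation.Binary.PropositionalEquality
open import Relation.Nullary using (yes; no; contradiction)

infix 4 _⊑_

_⊑_ : Word → Word → Set
u ⊑ v = ∃ λ t → u ++ t ≡ v

⊑-refl : ∀ {u} → u ⊑ u
⊑-refl {u} = [] , ++-identityʳ u

⊑-trans : ∀ {u v w} → u ⊑ v → v ⊑ w → u ⊑ w
⊑-trans {u} (t , refl) (t′ , refl) = t ++ t′ , sym (++-assoc u t t′)

++⁺-⊑ : ∀ u {v w} → v ⊑ w → u ++ v ⊑ u ++ w
++⁺-⊑ u {v} (t , refl) = t , ++-assoc u v t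

⊑-length : ∀ {u v} → u ⊑ v → length u ≤ length v
⊑-length {u} (t , refl) = length-++-≤ˡ u

nth-++ˡ : ∀ u v {k} → k < length u → nth (u ++ v) k ≡ nth u k
nth-++ˡ (x ∷ u) v {zero} _ = refl
nth-++ˡ (x ∷ u) v {suc k} (s≤s k<|u|) = nth-++ˡ u v k<|u|

nth-++ʳ : ∀ u v k → nth (u ++ v) (length u + k) ≡ nth v k
nth-++ʳ [] v k = refl
nth-++ʳ (x ∷ u) v k = nth-++ʳ u v k

nth-⊑ : ∀ {u v k} → u ⊑ v → k < length u → nth v k ≡ nth u k
nth-⊑ {u} (t , refl) = nth-++ˡ u t

length-pow : ∀ k w → length (pow k w) ≡ k * length w
length-pow zero w = refl
length-pow (suc k) w = trans (length-++ w) (cong (length w +_) (length-pow k w))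

pow-comm : ∀ k w → w ++ pow k w ≡ pow k w ++ w
pow-comm zero w = ++-identityʳ w
pow-comm (suc k) w = trans (cong (w ++_) (pow-comm k w)) (sym (++-assoc w (pow k w) w))

⊑-pow-++ˡ : ∀ {A} S R → 1 ≤ A → S ⊑ pow A S ++ R
⊑-pow-++ˡ {suc A} S R _ = pow A S ++ R , sym (++-assoc S (pow A S) R)

⊑-pow-++ʳ : ∀ A {S R} → R ⊑ S → R ⊑ pow A S ++ R
⊑-pow-++ʳ zero R⊑S = ⊑-refl
⊑-pow-++ʳ (suc A) {S} {R} R⊑S = ⊑-trans R⊑S (⊑-pow-++ˡ {suc A} S R (s≤s z≤n))

++-⊑-pow-++ : ∀ {A S R} → 1 ≤ A → R ⊑ S → S ++ R ⊑ pow A S ++ R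
++-⊑-pow-++ {suc A} {S} {R} _ R⊑S =
  subst (S ++ R ⊑_) (sym (++-assoc S (pow A S) R)) (++⁺-⊑ S (⊑-pow-++ʳ A R⊑S))

record BrokenPeriod (f : ℕ → ℕ) (p M : ℕ) : Set where
  field
    periodic : ∀ u → p + u < M → f (p + u) ≡ f u
    breaks : ∀ u → p + u ≡ M → f (p + u) ≢ f u

  open ≡-Reasoning

  iterate : ∀ j u → j * p + u < M → f (j * p + u) ≡ f u
  iterate zero u _ = refl
  iterate (suc j) u lt = begin
    f (p + j * p + u)   ≡⟨ cong f (+-assoc p (j * p) u) ⟩
    f (p + (j * p + u)) ≡⟨ periodic (j * p + u) lt′ ⟩
    f (j * p + u)       ≡⟨ iterate j u (≤-<-trans (m≤n+m (j * p + u) p) lt′) ⟩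
    f u                 ∎
    where
    lt′ : p + (j * p + u) < M
    lt′ = subst (_< M) (+-assoc p (j * p) u) lt

  iterate-breaks : 0 < p → ∀ j u → j ≢ 0 → j * p + u ≡ M → f (j * p + u) ≢ f u
  iterate-breaks _ zero u j≢0 _ = contradiction refl j≢0
  iterate-breaks 0<p (suc j) u _ e fj≡fu = breaks (j * p + u) e′ (begin
    f (p + (j * p + u)) ≡⟨ cong f (sym (+-assoc p (j * p) u)) ⟩
    f (p + j * p + u)   ≡⟨ fj≡fu ⟩
    f u                 ≡⟨ sym (iterate j u (subst (j * p + u <_) e′ (m<n+m (j * p + u) 0<p))) ⟩
    f (j * p + u)       ∎)
    where
    e′ : p + (j * p + u) ≡ M
    e′ = trans (sym (+-assoc p (j * p) u)) e

module Slope (a : ℕ → ℕ) (slope : IsSlope a) where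

  length-s : ∀ m → length (s a m) ≡ q a m
  length-s zero = refl
  length-s (suc zero) = begin
    length (pow (a 1 ∸ 1) (0 ∷ []) ++ 1 ∷ []) ≡⟨ length-++ (pow (a 1 ∸ 1) (0 ∷ [])) ⟩
    length (pow (a 1 ∸ 1) (0 ∷ [])) + 1      ≡⟨ cong (_+ 1) (trans (length-pow (a 1 ∸ 1) (0 ∷ [])) (*-identityʳ _)) ⟩
    a 1 ∸ 1 + 1                               ≡⟨ m∸n+n≡m (slope 0) ⟩
    a 1                                       ∎
    where open ≡-Reasoning
  length-s (suc (suc m)) = begin
    length (pow (a (2 + m)) (s a (suc m)) ++ s a m)
      ≡⟨ length-++ (pow (a (2 + m)) (s a (suc m))) ⟩
    length (pow (a (2 + m)) (s a (suc m))) + length (s a m)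
      ≡⟨ cong₂ _+_ (trans (length-pow (a (2 + m)) (s a (suc m))) (cong (a (2 + m) *_) (length-s (suc m))))
                   (length-s m) ⟩
    q a (2 + m) ∎
    where open ≡-Reasoning

  q-pos : ∀ m → 1 ≤ q a m
  q-pos zero = ≤-refl
  q-pos (suc zero) = slope 0
  q-pos (suc (suc m)) = ≤-trans (q-pos m) (m≤n+m (q a m) _)

  q-≥ : ∀ m → m ≤ q a m
  q-≥ zero = z≤n
  q-≥ (suc zero) = slope 0
  q-≥ (suc (suc m)) = begin
    2 + m                              ≡⟨ +-comm 1 (suc m) ⟩
    suc m + 1                          ≤⟨ +-mono-≤ (q-≥ (suc m)) (q-pos m) ⟩
    q a (suc m) + q a m                ≡⟨ cong (_+ q a m) (*-identityˡ (q a (suc m))) ⟨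
    1 * q a (suc m) + q a m            ≤⟨ +-monoˡ-≤ (q a m) (*-monoˡ-≤ (q a (suc m)) (slope (suc m))) ⟩
    q a (2 + m)                        ∎
    where open ≤-Reasoning

  s-⊑-next : ∀ m → s a (suc m) ⊑ s a (2 + m)
  s-⊑-next m = ⊑-pow-++ˡ (s a (suc m)) (s a m) (slope (suc m))

  s-⊑-s′ : ∀ {i j} → i ≤′ j → s a (suc i) ⊑ s a (suc j)
  s-⊑-s′ ≤′-refl = ⊑-refl
  s-⊑-s′ (≤′-step i≤′j) = ⊑-trans (s-⊑-s′ i≤′j) (s-⊑-next _)

  s-⊑-s : ∀ {i j} → i ≤ j → s a (suc i) ⊑ s a (suc j)
  s-⊑-s i≤j = s-⊑-s′ (≤⇒≤′ i≤j)

  q-mono : ∀ {i j} → i ≤ j → q a (suc i) ≤ q a (suc j)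
  q-mono {i} {j} i≤j = subst₂ _≤_ (length-s (suc i)) (length-s (suc j)) (⊑-length (s-⊑-s i≤j))

  c-nth-⊑ : ∀ j {u k} → u ⊑ s a (suc j) → k < length u → c a k ≡ nth u k
  c-nth-⊑ j {u} {k} u⊑s k<|u| with ≤-total j (suc k)
  ... | inj₁ j≤1+k = nth-⊑ (⊑-trans u⊑s (s-⊑-s j≤1+k)) k<|u|
  ... | inj₂ 1+k≤j = trans (sym (nth-⊑ (s-⊑-s 1+k≤j) k<q)) (nth-⊑ u⊑s k<|u|)
    where
    k<q : k < length (s a (2 + k))
    k<q = subst (k <_) (sym (length-s (2 + k))) (≤-trans (n≤1+n (suc k)) (q-≥ (2 + k)))

  s-almost-commute : ∀ m → ∃ λ w → ∃₂ λ x y → x ≢ y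
    × s a (suc m) ++ s a m ≡ w ++ x ∷ y ∷ []
    × s a m ++ s a (suc m) ≡ w ++ y ∷ x ∷ []
  s-almost-commute zero = P , 1 , 0 , (λ ()) , ++-assoc P (1 ∷ []) (0 ∷ []) ,
    trans (cong (_++ 1 ∷ []) (pow-comm (a 1 ∸ 1) (0 ∷ []))) (++-assoc P (0 ∷ []) (1 ∷ []))
    where P = pow (a 1 ∸ 1) (0 ∷ [])
  s-almost-commute (suc m) with s-almost-commute m
  ... | w , x , y , x≢y , SR≡ , RS≡ = P ++ w , y , x , ≢-sym x≢y , PRS≡ , SPR≡
    where
    open ≡-Reasoning
    S = s a (suc m)
    R = s a m
    P = pow (a (2 + m)) S
    PRS≡ : (P ++ R) ++ S ≡ (P ++ w) ++ y ∷ x ∷ []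
    PRS≡ = begin
      (P ++ R) ++ S             ≡⟨ ++-assoc P R S ⟩
      P ++ (R ++ S)             ≡⟨ cong (P ++_) RS≡ ⟩
      P ++ (w ++ y ∷ x ∷ [])    ≡⟨ ++-assoc P w _ ⟨
      (P ++ w) ++ y ∷ x ∷ []    ∎
    SPR≡ : S ++ (P ++ R) ≡ (P ++ w) ++ x ∷ y ∷ []
    SPR≡ = begin
      S ++ (P ++ R)             ≡⟨ ++-assoc S P R ⟨
      (S ++ P) ++ R             ≡⟨ cong (_++ R) (pow-comm (a (2 + m)) S) ⟩
      (P ++ S) ++ R             ≡⟨ ++-assoc P S R ⟩
      P ++ (S ++ R)             ≡⟨ cong (P ++_) SR≡ ⟩
      P ++ (w ++ x ∷ y ∷ [])    ≡⟨ ++-assoc P w _ ⟨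
      (P ++ w) ++ x ∷ y ∷ []    ∎

  c-broken-period : ∀ i → BrokenPeriod (c a) (q a (suc i)) (q a (2 + i) + q a (suc i) ∸ 2)
  c-broken-period i with s-almost-commute (suc i)
  ... | w , x , y , x≢y , S₂S₁≡ , S₁S₂≡ = record { periodic = periodic ; breaks = breaks }
    where
    S₂ = s a (2 + i)
    S₁ = s a (suc i)
    Q = q a (suc i)

    length-S₁S₂ : length (S₁ ++ S₂) ≡ Q + q a (2 + i)
    length-S₁S₂ = trans (length-++ S₁) (cong₂ _+_ (length-s (suc i)) (length-s (2 + i)))

    length-w+2 : length w + 2 ≡ Q + q a (2 + i)
    length-w+2 = trans (sym (length-++ w)) (trans (cong length (sym S₁S₂≡)) length-S₁S₂)

    M≡length-w : q a (2 + i) + Q ∸ 2 ≡ length w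
    M≡length-w = begin
      q a (2 + i) + Q ∸ 2  ≡⟨ cong (_∸ 2) (trans (+-comm (q a (2 + i)) Q) (sym length-w+2)) ⟩
      length w + 2 ∸ 2     ≡⟨ m+n∸n≡m (length w) 2 ⟩
      length w             ∎
      where open ≡-Reasoning

    length-S₂S₁ : length (S₂ ++ S₁) ≡ length w + 2
    length-S₂S₁ = trans (cong length S₂S₁≡) (length-++ w)

    c-via-S₂S₁ : ∀ {k} → k < length w + 2 → c a k ≡ nth (w ++ x ∷ y ∷ []) k
    c-via-S₂S₁ {k} k<|w|+2 =
      trans (c-nth-⊑ (2 + i) (++-⊑-pow-++ (slope (2 + i)) (s-⊑-next i)) (subst (k <_) (sym length-S₂S₁) k<|w|+2))
            (cong (λ v → nth v k) S₂S₁≡)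

    u<|S₂| : ∀ {u} → Q + u ≤ length w → u < length S₂
    u<|S₂| {u} Q+u≤|w| = +-cancelˡ-< Q u (length S₂) (begin-strict
      Q + u            ≤⟨ Q+u≤|w| ⟩
      length w         <⟨ m<m+n (length w) (s≤s z≤n) ⟩
      length w + 2     ≡⟨ length-w+2 ⟩
      Q + q a (2 + i)  ≡⟨ cong (Q +_) (length-s (2 + i)) ⟨
      Q + length S₂    ∎)
      where open ≤-Reasoning

    c-via-S₁S₂ : ∀ {u} → Q + u ≤ length w → c a u ≡ nth (w ++ y ∷ x ∷ []) (Q + u)
    c-via-S₁S₂ {u} Q+u≤|w| = begin
      c a u                      ≡⟨ c-nth-⊑ (suc i) (⊑-refl {S₂}) (u<|S₂| Q+u≤|w|) ⟩
      nth S₂ u                   ≡⟨ subst (λ n → nth (S₁ ++ S₂) (n + u) ≡ nth S₂ u) (length-s (suc i)) (nth-++ʳ S₁ S₂ u) ⟨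
      nth (S₁ ++ S₂) (Q + u)     ≡⟨ cong (λ v → nth v (Q + u)) S₁S₂≡ ⟩
      nth (w ++ y ∷ x ∷ []) (Q + u) ∎
      where open ≡-Reasoning

    periodic : ∀ u → Q + u < q a (2 + i) + Q ∸ 2 → c a (Q + u) ≡ c a u
    periodic u lt = begin
      c a (Q + u)                   ≡⟨ c-via-S₂S₁ (<-trans lt′ (m<m+n (length w) (s≤s z≤n))) ⟩
      nth (w ++ x ∷ y ∷ []) (Q + u) ≡⟨ nth-++ˡ w _ lt′ ⟩
      nth w (Q + u)                 ≡⟨ nth-++ˡ w _ lt′ ⟨
      nth (w ++ y ∷ x ∷ []) (Q + u) ≡⟨ c-via-S₁S₂ (<⇒≤ lt′) ⟨
      c a u                         ∎
      where
      open ≡-Reasoning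
      lt′ : Q + u < length w
      lt′ = subst (Q + u <_) M≡length-w lt

    breaks : ∀ u → Q + u ≡ q a (2 + i) + Q ∸ 2 → c a (Q + u) ≢ c a u
    breaks u e c≡ = x≢y (begin
      x                             ≡⟨ letter-after-w x _ ⟨
      nth (w ++ x ∷ y ∷ []) (Q + u) ≡⟨ c-via-S₂S₁ (subst (_< length w + 2) (sym e′) (m<m+n (length w) (s≤s z≤n))) ⟨
      c a (Q + u)                   ≡⟨ c≡ ⟩
      c a u                         ≡⟨ c-via-S₁S₂ (≤-reflexive e′) ⟩
      nth (w ++ y ∷ x ∷ []) (Q + u) ≡⟨ letter-after-w y _ ⟩
      y                             ∎)
      where
      open ≡-Reasoning
      e′ : Q + u ≡ length w
      e′ = trans e M≡length-w
      letter-after-w : ∀ z zs → nth (w ++ z ∷ zs) (Q + u) ≡ z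
      letter-after-w z zs = trans (cong (nth (w ++ z ∷ zs)) (trans e′ (sym (+-identityʳ (length w)))))
                                  (nth-++ʳ w (z ∷ zs) 0)

ρ-stable : ∀ {a b n m} → n ≤′ m → (∀ M → n ≤ M → M < m → b (suc M) ≡ 0) → ρ a b m ≡ ρ a b n
ρ-stable ≤′-refl _ = refl
ρ-stable {a} {b} {n} (≤′-step {m} n≤′m) zeros = begin
  ρ a b m + b (suc m) * q a m ≡⟨ cong (λ β → ρ a b m + β * q a m) (zeros m (≤′⇒≤ n≤′m) ≤-refl) ⟩
  ρ a b m + 0                 ≡⟨ +-identityʳ (ρ a b m) ⟩
  ρ a b m                     ≡⟨ ρ-stable n≤′m (λ M n≤M M<m → zeros M n≤M (m≤n⇒m≤1+n M<m)) ⟩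
  ρ a b n                     ∎
  where open ≡-Reasoning

module OstrowskiNumber (a b : ℕ → ℕ) (slope : IsSlope a) (ost : Ostrowski a b) where

  open Slope a slope

  ρ<q-step : ∀ m → ρ a b m < q a m → ρ a b (suc m) < q a (suc m) → ρ a b (2 + m) < q a (2 + m)
  ρ<q-step m ρₘ<qₘ ρₘ₊₁<qₘ₊₁ with b (2 + m) ≟ a (2 + m)
  ... | yes bₘ₊₂≡aₘ₊₂ = begin-strict
    ρ a b (suc m) + b (2 + m) * q a (suc m) ≡⟨ cong₂ _+_ ρₘ₊₁≡ρₘ (cong (_* q a (suc m)) bₘ₊₂≡aₘ₊₂) ⟩
    ρ a b m + a (2 + m) * q a (suc m)       <⟨ +-monoˡ-< (a (2 + m) * q a (suc m)) ρₘ<qₘ ⟩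
    q a m + a (2 + m) * q a (suc m)         ≡⟨ +-comm (q a m) _ ⟩
    q a (2 + m)                             ∎
    where
    open ≤-Reasoning
    ρₘ₊₁≡ρₘ : ρ a b (suc m) ≡ ρ a b m
    ρₘ₊₁≡ρₘ = begin-equality
      ρ a b m + b (suc m) * q a m ≡⟨ cong (λ β → ρ a b m + β * q a m) (proj₂ (proj₂ ost) m bₘ₊₂≡aₘ₊₂) ⟩
      ρ a b m + 0                 ≡⟨ +-identityʳ (ρ a b m) ⟩
      ρ a b m                     ∎
  ... | no bₘ₊₂≢aₘ₊₂ = begin-strict
    ρ a b (suc m) + b (2 + m) * q a (suc m)  <⟨ +-monoˡ-< (b (2 + m) * q a (suc m)) ρₘ₊₁<qₘ₊₁ ⟩
    suc (b (2 + m)) * q a (suc m)            ≤⟨ *-monoˡ-≤ (q a (suc m)) (≤∧≢⇒< (proj₁ (proj₂ ost) (suc m)) bₘ₊₂≢aₘ₊₂) ⟩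
    a (2 + m) * q a (suc m)                  ≤⟨ m≤m+n _ (q a m) ⟩
    q a (2 + m)                              ∎
    where open ≤-Reasoning

  ρ<q : ∀ m → ρ a b m < q a m
  ρ<q zero = s≤s z≤n
  ρ<q (suc zero) = begin-strict
    b 1 * 1      ≡⟨ *-identityʳ (b 1) ⟩
    b 1          ≤⟨ proj₁ ost ⟩
    a 1 ∸ 1      <⟨ m<m+n (a 1 ∸ 1) (s≤s z≤n) ⟩
    a 1 ∸ 1 + 1  ≡⟨ m∸n+n≡m (slope 0) ⟩
    a 1          ∎
    where open ≤-Reasoning
  ρ<q (suc (suc m)) = ρ<q-step m (ρ<q m) (ρ<q (suc m))

  ρ+2≤q+q : ∀ i → ρ a b (2 + i) + 2 ≤ q a (2 + i) + q a (suc i)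
  ρ+2≤q+q i = begin
    ρ a b (2 + i) + 2      ≡⟨ +-suc (ρ a b (2 + i)) 1 ⟩
    suc (ρ a b (2 + i)) + 1 ≤⟨ +-mono-≤ (ρ<q (2 + i)) (q-pos (suc i)) ⟩
    q a (2 + i) + q a (suc i) ∎
    where open ≤-Reasoning

  lamN-spec : ∀ i → 2 + (lamN a b (suc i) + ρ a b (2 + i)) ≡ q a (2 + i) + q a (suc i)
  lamN-spec i = begin
    2 + (λₙ + ρ₂)           ≡⟨ +-comm 2 (λₙ + ρ₂) ⟩
    λₙ + ρ₂ + 2             ≡⟨ +-assoc λₙ ρ₂ 2 ⟩
    λₙ + (ρ₂ + 2)           ≡⟨ cong (_+ (ρ₂ + 2)) (∸-+-assoc X ρ₂ 2) ⟩
    X ∸ (ρ₂ + 2) + (ρ₂ + 2) ≡⟨ m∸n+n≡m (ρ+2≤q+q i) ⟩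
    X                       ∎
    where
    open ≡-Reasoning
    λₙ = lamN a b (suc i)
    ρ₂ = ρ a b (2 + i)
    X = q a (2 + i) + q a (suc i)

  lamN+ρ≡ : ∀ i → lamN a b (suc i) + ρ a b (2 + i) ≡ q a (2 + i) + q a (suc i) ∸ 2
  lamN+ρ≡ i = trans (sym (m+n∸m≡n 2 _)) (cong (_∸ 2) (lamN-spec i))

  q≤1+lamN : ∀ i → q a (suc i) ≤ suc (lamN a b (suc i))
  q≤1+lamN i = +-cancelˡ-≤ (suc ρ₂) (q a (suc i)) (suc λₙ) (begin
    suc ρ₂ + q a (suc i)      ≤⟨ +-monoˡ-≤ (q a (suc i)) (ρ<q (2 + i)) ⟩
    q a (2 + i) + q a (suc i) ≡⟨ lamN-spec i ⟨
    2 + (λₙ + ρ₂)             ≡⟨ cong (2 +_) (+-comm λₙ ρ₂) ⟩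
    2 + (ρ₂ + λₙ)             ≡⟨ cong suc (+-suc ρ₂ λₙ) ⟨
    suc ρ₂ + suc λₙ           ∎)
    where
    open ≤-Reasoning
    λₙ = lamN a b (suc i)
    ρ₂ = ρ a b (2 + i)

  2+lamN≤q : ∀ i → b (2 + i) ≢ 0 → 2 + lamN a b (suc i) ≤ q a (2 + i)
  2+lamN≤q i bᵢ₊₂≢0 = +-cancelʳ-≤ Q (2 + λₙ) (q a (2 + i)) (begin
    2 + λₙ + Q                   ≤⟨ +-monoʳ-≤ (2 + λₙ) (≤-trans (m≤n*m Q (b (2 + i)) {{≢-nonZero bᵢ₊₂≢0}}) (m≤n+m _ (ρ a b (suc i)))) ⟩
    2 + λₙ + ρ a b (2 + i)       ≡⟨ lamN-spec i ⟩
    q a (2 + i) + Q              ∎)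
    where
    open ≤-Reasoning
    Q = q a (suc i)
    λₙ = lamN a b (suc i)

  ρ-suc-shift : ∀ i k → ρ a b (2 + i) + k ≡ b (2 + i) * q a (suc i) + (ρ a b (suc i) + k)
  ρ-suc-shift i k = trans (cong (_+ k) (+-comm (ρ a b (suc i)) (b (2 + i) * q a (suc i))))
                          (+-assoc (b (2 + i) * q a (suc i)) (ρ a b (suc i)) k)

  c-ρ-step-agree : ∀ i k → k < lamN a b (suc i) → c a (ρ a b (2 + i) + k) ≡ c a (ρ a b (suc i) + k)
  c-ρ-step-agree i k k<λ = trans (cong (c a) (ρ-suc-shift i k))
    (BrokenPeriod.iterate (c-broken-period i) (b (2 + i)) (ρ a b (suc i) + k) (begin-strict
      b (2 + i) * q a (suc i) + (ρ a b (suc i) + k) ≡⟨ ρ-suc-shift i k ⟨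
      ρ a b (2 + i) + k                             <⟨ +-monoʳ-< (ρ a b (2 + i)) k<λ ⟩
      ρ a b (2 + i) + lamN a b (suc i)              ≡⟨ +-comm (ρ a b (2 + i)) _ ⟩
      lamN a b (suc i) + ρ a b (2 + i)              ≡⟨ lamN+ρ≡ i ⟩
      q a (2 + i) + q a (suc i) ∸ 2                 ∎))
    where open ≤-Reasoning

  c-ρ-step-breaks : ∀ i → b (2 + i) ≢ 0 →
    c a (ρ a b (2 + i) + lamN a b (suc i)) ≢ c a (ρ a b (suc i) + lamN a b (suc i))
  c-ρ-step-breaks i bᵢ₊₂≢0 = subst (λ v → c a v ≢ c a (ρ a b (suc i) + λₙ)) (sym (ρ-suc-shift i λₙ))
    (BrokenPeriod.iterate-breaks (c-broken-period i) (q-pos (suc i)) (b (2 + i)) (ρ a b (suc i) + λₙ) bᵢ₊₂≢0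
      (trans (sym (ρ-suc-shift i λₙ)) (trans (+-comm (ρ a b (2 + i)) λₙ) (lamN+ρ≡ i))))
    where λₙ = lamN a b (suc i)

  c-ρ-stable : ∀ {j j′} → j ≤′ j′ → ∀ k → suc k < q a (suc j) →
    c a (ρ a b (suc j′) + k) ≡ c a (ρ a b (suc j) + k)
  c-ρ-stable ≤′-refl k _ = refl
  c-ρ-stable {j} (≤′-step {j′} j≤′j′) k 1+k<q = trans
    (c-ρ-step-agree j′ k (≤-pred (≤-trans 1+k<q (≤-trans (q-mono (≤′⇒≤ j≤′j′)) (q≤1+lamN j′)))))
    (c-ρ-stable j≤′j′ k 1+k<q)

  Tρc-at : ∀ j k → suc k < q a (suc j) → Tρc a b k ≡ c a (ρ a b (suc j) + k)
  Tρc-at j k 1+k<q with ≤-total j (suc k)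
  ... | inj₁ j≤1+k = c-ρ-stable (≤⇒≤′ j≤1+k) k 1+k<q
  ... | inj₂ 1+k≤j = sym (c-ρ-stable (≤⇒≤′ 1+k≤j) k (q-≥ (2 + k)))

  Tρc-lcp : ∀ i → b (2 + i) ≢ 0 → LCPLength (Tρc a b) (T^ (ρ a b (suc i)) (c a)) (lamN a b (suc i))
  Tρc-lcp i bᵢ₊₂≢0 = agree , differ
    where
    λₙ = lamN a b (suc i)
    1+λ<q : suc λₙ < q a (2 + i)
    1+λ<q = 2+lamN≤q i bᵢ₊₂≢0
    agree : ∀ k → k < λₙ → Tρc a b k ≡ c a (ρ a b (suc i) + k)
    agree k k<λ = trans (Tρc-at (suc i) k (<-trans (s≤s k<λ) 1+λ<q)) (c-ρ-step-agree i k k<λ)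
    differ : Tρc a b λₙ ≢ c a (ρ a b (suc i) + λₙ)
    differ eq = c-ρ-step-breaks i bᵢ₊₂≢0 (trans (sym (Tρc-at (suc i) λₙ 1+λ<q)) eq)

mainTheorem12 : (a b : ℕ → ℕ) → IsSlope a → Ostrowski a b → (n : ℕ) → 1 ≤ n →
    ((N : ℕ) → n ≤ N → b (suc N) ≢ 0 → ((M : ℕ) → n ≤ M → M < N → b (suc M) ≡ 0) →
      LCPLength (Tρc a b) (T^ (ρ a b n) (c a)) (lamN a b N))
    × (((N : ℕ) → n ≤ N → b (suc N) ≡ 0) →
      (k : ℕ) → Tρc a b k ≡ T^ (ρ a b n) (c a) k)
mainTheorem12 a b slope ost n 1≤n = lcp , equal
  where
  open Slope a slope
  open OstrowskiNumber a b slope ost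
  lcp : (N : ℕ) → n ≤ N → b (suc N) ≢ 0 → ((M : ℕ) → n ≤ M → M < N → b (suc M) ≡ 0) →
    LCPLength (Tρc a b) (T^ (ρ a b n) (c a)) (lamN a b N)
  lcp zero n≤0 _ _ = contradiction n≤0 (<⇒≱ 1≤n)
  lcp (suc i) n≤N bN≢0 zeros =
    subst (λ r → LCPLength (Tρc a b) (T^ r (c a)) (lamN a b (suc i))) (ρ-stable (≤⇒≤′ n≤N) zeros) (Tρc-lcp i bN≢0)
  equal : ((N : ℕ) → n ≤ N → b (suc N) ≡ 0) → (k : ℕ) → Tρc a b k ≡ T^ (ρ a b n) (c a) k
  equal zeros k = trans (Tρc-at (suc k + n) k (≤-trans (s≤s (s≤s (m≤m+n k n))) (q-≥ (2 + k + n))))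
    (cong (λ r → c a (r + k)) (ρ-stable (≤⇒≤′ (m≤n+m n (2 + k))) (λ M n≤M _ → zeros M n≤M)))
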